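{- For a finite poset $\mathcal{P}=(N,\preccurlyeq)$ define $f_{\mathcal{P}}\colon 2^N\to\mathbb{R}$ by \[ f_{\mathcal{P}}(X)=\bigl|\{\, j\in N\setminus X : \text{there exists } i\in X \text{ with } j\prec i\,\}\bigr| \qquad (X\subseteq N), \] where $j\prec i$ means $j\preccurlyeq i$ and $j\neq i$. Then $f_{\mathcal{P}}$ is not $\mathrm{M}^\natural$-concave in general; that is, there exists a finite poset $\mathcal{P}$ for which $f_{\mathcal{P}}$ is not $\mathrm{M}^\natural$-concave.
   Context: A set function $f\colon 2^N\to\mathbb{R}$ on a finite set $N$ is $\mathrm{M}^\natural$-concave if for all $X,Y\subseteq N$ and every $i\in X\setminus Y$, either $f(X)+f(Y)\le f(X\setminus\{i\})+f(Y\cup\{i\})$, or there exists $j\in Y\setminus X$ with $f(X)+f(Y)\le f((X\setminus\{i\})\cup\{j\})+f((Y\cup\{i\})\setminus\{j\})$. -}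

module Defs where

open import Data.Nat using (ℕ; _+_; _≤_)
open import Data.Fin using (Fin)
open import Data.Fin.Subset using (Subset; _∈_; _∉_; ∣_∣; ⁅_⁆; _∪_; _─_)
open import Data.Fin.Subset.Properties using (_∈?_)
open import Data.Vec using (tabulate)
open import Data.Bool using (Bool; true; false)
open import Data.Product using (Σ; _×_; ∃; _,_)
open import Data.Sum using (_⊎_)
open import Relation.Nullary using (¬_; Dec; does)
open import Relation.Binary.PropositionalEquality using (_≡_)
open import Relation.Binary.Structures using (IsDecPartialOrder)

-- A finite poset on the ground set N = Fin n (order relation decidable,
-- which is automatic for finite relations classically).
record FinPoset (n : ℕ) : Set₁ where
  field
    _≼_ : Fin n → Fin n → Set
    isDecPartialOrder : IsDecPartialOrder _≡_ _≼_

  _≺_ : Fin n → Fin n → Set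
  j ≺ i = j ≼ i × ¬ (j ≡ i)

  open IsDecPartialOrder isDecPartialOrder public using (_≤?_; _≟_)

module _ {n : ℕ} (P : FinPoset n) where
  open FinPoset P
  open import Relation.Nullary.Decidable using (_×-dec_; ¬?; _⊎-dec_)
  open import Data.Fin.Properties using (any?)

  below? : (X : Subset n) (j : Fin n) → Dec (j ∉ X × ∃ λ i → i ∈ X × j ≺ i)
  below? X j = ¬? (j ∈? X) ×-dec any? (λ i → (i ∈? X) ×-dec ((j ≤? i) ×-dec ¬? (j ≟ i)))

  fP : Subset n → ℕ
  fP X = ∣ tabulate (λ j → does (below? X j)) ∣

-- M♮-concavity of a set function f : 2^N → ℕ (values viewed as reals;
-- inequalities between natural numbers coincide with those in ℝ).
IsM♮Concave : {n : ℕ} → (Subset n → ℕ) → Set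
IsM♮Concave {n} f =
  ∀ (X Y : Subset n) (i : Fin n) → i ∈ X → i ∉ Y →
    (f X + f Y ≤ f (X ─ ⁅ i ⁆) + f (Y ∪ ⁅ i ⁆))
    ⊎ (∃ λ j → j ∈ Y × j ∉ X ×
         (f X + f Y ≤ f ((X ─ ⁅ i ⁆) ∪ ⁅ j ⁆) + f ((Y ∪ ⁅ i ⁆) ─ ⁅ j ⁆)))

-- Take the poset with two incomparable elements below a common top, X = {top}
-- and Y = {left, right}. Then f X + f Y = 2 + 0, since both bottoms lie below
-- top. Moving top from X to Y gives 0 + 0, and exchanging top for a bottom
-- element b gives 0 + 1: only the other bottom element is still counted.
module Submission where

open import Defs
open import Data.Nat using (ℕ; _+_; _≤_; s≤s)
open import Data.Product using (Σ; ∃; _×_; _,_)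
open import Data.Sum using (_⊎_; inj₁; inj₂)
open import Data.Empty using (⊥)
open import Data.Fin using (Fin; zero; suc)
open import Data.Fin.Properties using (_≟_)
open import Data.Fin.Subset using (Subset; _∈_; _∉_; ⁅_⁆; _∪_; _─_)
open import Data.Vec using (here; there)
open import Relation.Nullary using (¬_; Dec; yes; no)
open import Relation.Binary.PropositionalEquality using (_≡_; refl; isEquivalence)

pattern left  = zero
pattern top   = suc zero
pattern right = suc (suc zero)

data _≼_ : Fin 3 → Fin 3 → Set where
  ≼-refl     : ∀ {a} → a ≼ a
  left≼top  : left ≼ top
  right≼top : right ≼ top

_≼?_ : (a b : Fin 3) → Dec (a ≼ b)
left  ≼? left  = yes ≼-refl
left  ≼? top   = yes left≼top
left  ≼? right = no λ ()
top   ≼? left  = no λ ()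
top   ≼? top   = yes ≼-refl
top   ≼? right = no λ ()
right ≼? left  = no λ ()
right ≼? top   = yes right≼top
right ≼? right = yes ≼-refl

≼-trans : ∀ {a b c} → a ≼ b → b ≼ c → a ≼ c
≼-trans ≼-refl    q      = q
≼-trans left≼top  ≼-refl = left≼top
≼-trans right≼top ≼-refl = right≼top

≼-antisym : ∀ {a b} → a ≼ b → b ≼ a → a ≡ b
≼-antisym ≼-refl _ = refl

Λ-poset : FinPoset 3
Λ-poset = record
  { _≼_ = _≼_
  ; isDecPartialOrder = record
    { isPartialOrder = record
      { isPreorder = record
        { isEquivalence = isEquivalence
        ; reflexive     = λ { refl → ≼-refl }
        ; trans         = ≼-trans
        }
      ; antisym = ≼-antisym
      }
    ; _≟_  = _≟_
    ; _≤?_ = _≼?_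
    }
  }

f : Subset 3 → ℕ
f = fP Λ-poset

X Y : Subset 3
X = ⁅ top ⁆
Y = ⁅ left ⁆ ∪ ⁅ right ⁆

top∈X : top ∈ X
top∈X = there here

top∉Y : top ∉ Y
top∉Y (there ())

moving-top-decreases : ¬ (f X + f Y ≤ f (X ─ ⁅ top ⁆) + f (Y ∪ ⁅ top ⁆))
moving-top-decreases ()

exchanging-top-decreases : ∀ j → j ∈ Y →
  ¬ (f X + f Y ≤ f ((X ─ ⁅ top ⁆) ∪ ⁅ j ⁆) + f ((Y ∪ ⁅ top ⁆) ─ ⁅ j ⁆))
exchanging-top-decreases left  _ (s≤s ())
exchanging-top-decreases right _ (s≤s ())
exchanging-top-decreases top   (there ())

proposition3 : Σ ℕ λ n → Σ (FinPoset n) λ P → ¬ IsM♮Concave (fP P)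
proposition3 = 3 , Λ-poset , λ concave → refute (concave X Y top top∈X top∉Y)
  where
  refute : (f X + f Y ≤ f (X ─ ⁅ top ⁆) + f (Y ∪ ⁅ top ⁆))
         ⊎ (∃ λ j → j ∈ Y × j ∉ X ×
              (f X + f Y ≤ f ((X ─ ⁅ top ⁆) ∪ ⁅ j ⁆) + f ((Y ∪ ⁅ top ⁆) ─ ⁅ j ⁆)))
         → ⊥
  refute (inj₁ ineq)                  = moving-top-decreases ineq
  refute (inj₂ (j , j∈Y , _ , ineq)) = exchanging-top-decreases j j∈Y ineq
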